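{- Let $G$ be a maximal outerplanar graph with $G\not\cong K_3$. Then $D'(G)\leq 2$.
   Context: All graphs are finite, simple and undirected. A maximal outerplanar graph is an outerplanar graph to which no edge can be added while preserving outerplanarity; equivalently, a graph isomorphic to a triangulation of a polygon (it has at least $3$ vertices). An edge labeling $\psi:E(G)\to\{1,\dots,d\}$ is distinguishing if the only automorphism of $G$ preserving all edge labels (i.e. $\psi(\sigma(e))=\psi(e)$ for every edge $e$, where $\sigma$ acts on edges via its action on endpoints) is the identity. The distinguishing index $D'(G)$ is the least $d$ such that $G$ has a distinguishing edge labeling with $d$ labels. -}

module Defs where

open import Data.Nat using (ℕ; zero; suc; _<_; _≤_; _∸_; _⊓_; _⊔_)
open import Data.Fin using (Fin; toℕ)
open import Data.Fin.Permutation using (Permutation; Permutation′; _⟨$⟩ʳ_)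
open import Data.Bool using (Bool; true; false)
open import Data.Product using (Σ; _×_; ∃; ∃-syntax)
open import Data.Sum using (_⊎_)
open import Relation.Binary.PropositionalEquality using (_≡_)
open import Relation.Nullary using (¬_)

record Graph : Set where
  field
    n     : ℕ
    Adj   : Fin n → Fin n → Bool
    sym   : ∀ u v → Adj u v ≡ Adj v u
    irr   : ∀ v → Adj v v ≡ false
open Graph public

_≅_ : Graph → Graph → Set
G ≅ H = Σ (Permutation (n G) (n H)) λ π →
          ∀ u v → Adj H (π ⟨$⟩ʳ u) (π ⟨$⟩ʳ v) ≡ Adj G u v

K3adj : Fin 3 → Fin 3 → Bool
K3adj Fin.zero Fin.zero = false
K3adj (Fin.suc Fin.zero) (Fin.suc Fin.zero) = false
K3adj (Fin.suc (Fin.suc Fin.zero)) (Fin.suc (Fin.suc Fin.zero)) = false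
K3adj _ _ = true

K3 : Graph
K3 = record { n = 3 ; Adj = K3adj ; sym = s ; irr = i }
  where
  open import Relation.Binary.PropositionalEquality using (refl)
  s : ∀ u v → K3adj u v ≡ K3adj v u
  s Fin.zero Fin.zero = refl
  s Fin.zero (Fin.suc Fin.zero) = refl
  s Fin.zero (Fin.suc (Fin.suc Fin.zero)) = refl
  s (Fin.suc Fin.zero) Fin.zero = refl
  s (Fin.suc Fin.zero) (Fin.suc Fin.zero) = refl
  s (Fin.suc Fin.zero) (Fin.suc (Fin.suc Fin.zero)) = refl
  s (Fin.suc (Fin.suc Fin.zero)) Fin.zero = refl
  s (Fin.suc (Fin.suc Fin.zero)) (Fin.suc Fin.zero) = refl
  s (Fin.suc (Fin.suc Fin.zero)) (Fin.suc (Fin.suc Fin.zero)) = refl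
  i : ∀ v → K3adj v v ≡ false
  i Fin.zero = refl
  i (Fin.suc Fin.zero) = refl
  i (Fin.suc (Fin.suc Fin.zero)) = refl

-- Convex polygon with vertices 0,1,…,m-1 in cyclic order.
-- Chords {a,b} and {c,d} (a<b, c<d) cross iff a < c < b < d.
CrossOrd : ℕ → ℕ → ℕ → ℕ → Set
CrossOrd a b c d = (a < c) × (c < b) × (b < d)

Crossing : {m : ℕ} → Fin m → Fin m → Fin m → Fin m → Set
Crossing a b c d =
  CrossOrd (toℕ a ⊓ toℕ b) (toℕ a ⊔ toℕ b) (toℕ c ⊓ toℕ d) (toℕ c ⊔ toℕ d)
  ⊎ CrossOrd (toℕ c ⊓ toℕ d) (toℕ c ⊔ toℕ d) (toℕ a ⊓ toℕ b) (toℕ a ⊔ toℕ b)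

record IsPolygonTriangulation (m : ℕ) (T : Fin m → Fin m → Bool) : Set where
  field
    three≤m   : 3 ≤ m
    sides     : ∀ i j → suc (toℕ i) ≡ toℕ j → T i j ≡ true
    closing   : ∀ i j → toℕ i ≡ 0 → toℕ j ≡ m ∸ 1 → T i j ≡ true
    nonCross  : ∀ a b c d → T a b ≡ true → T c d ≡ true → ¬ Crossing a b c d
    maximal   : ∀ a b → ¬ (a ≡ b) → T a b ≡ false →
                  ∃[ c ] ∃[ d ] (T c d ≡ true × Crossing a b c d)

-- Maximal outerplanar graph: a graph isomorphic to a triangulation of a polygon,
-- i.e. for some triangulation T of the convex n-gon there is a bijection
-- of vertices carrying adjacency of G exactly to T.
MaximalOuterplanar : Graph → Set
MaximalOuterplanar G =
  Σ (Fin (n G) → Fin (n G) → Bool) λ T →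
    IsPolygonTriangulation (n G) T ×
    Σ (Permutation′ (n G)) λ π →
      ∀ u v → T (π ⟨$⟩ʳ u) (π ⟨$⟩ʳ v) ≡ Adj G u v

-- An edge labeling with d labels: a label for each (unordered) edge,
-- represented as a function on vertex pairs that is symmetric on edges
-- (values on non-edges are irrelevant).
record EdgeLabeling (G : Graph) (d : ℕ) : Set where
  field
    ψ    : Fin (n G) → Fin (n G) → Fin d
    ψsym : ∀ u v → Adj G u v ≡ true → ψ u v ≡ ψ v u
open EdgeLabeling public

IsAutomorphism : (G : Graph) → Permutation′ (n G) → Set
IsAutomorphism G σ = ∀ u v → Adj G (σ ⟨$⟩ʳ u) (σ ⟨$⟩ʳ v) ≡ Adj G u v

PreservesLabels : (G : Graph) {d : ℕ} → EdgeLabeling G d → Permutation′ (n G) → Set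
PreservesLabels G L σ =
  ∀ u v → Adj G u v ≡ true → ψ L (σ ⟨$⟩ʳ u) (σ ⟨$⟩ʳ v) ≡ ψ L u v

IsDistinguishing : (G : Graph) {d : ℕ} → EdgeLabeling G d → Set
IsDistinguishing G L = ∀ σ → IsAutomorphism G σ → PreservesLabels G L σ →
                         ∀ v → σ ⟨$⟩ʳ v ≡ v

-- D'(G) ≤ d  iff  G has a distinguishing edge labeling with d labels.
DistIndex≤ : Graph → ℕ → Set
DistIndex≤ G d = Σ (EdgeLabeling G d) λ L → IsDistinguishing G L

module Submission where

-- Transport G to a triangulation T of the convex polygon with vertices
-- 0, 1, …, M (M ≥ 3); the sides of the polygon are edges of T.  We use two
-- candidate 2-labelings, each colouring the edges of a path red:
--   (A) the Hamiltonian path 0 — 1 — ⋯ — M, and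
--   (B) the path 1 — 2 — ⋯ — M, leaving vertex 0 without red edges.
-- An automorphism preserving the labels preserves the red path, so by the
-- rigidity of paths it is the identity or the reversal of that path:
-- x ↦ M − x for (A), and the reflection fixing 0 for (B).  If one of these
-- two reflections is not an automorphism of T, the corresponding labeling
-- is distinguishing.  If both were automorphisms, so would be their
-- composite, the rotation x ↦ x − 1; but a rotation by one step moves a
-- diagonal of T to a diagonal crossing it, which is impossible.

open import Defs hiding (sym)
open import Data.Nat using (ℕ; zero; suc; _+_; _∸_; _⊓_; _⊔_; _≤_; _<_; z≤n; s≤s; _≟_; _<?_)
open import Data.Nat.Properties
  using ( ≤-refl; ≤-trans; ≤-antisym; <-irrefl; ≤-pred; <⇒≤; ≰⇒>; n≤1+n; m≤n+m
        ; m≤n⇒m<n∨m≡n; +-identityʳ; +-suc; +-cancelʳ-≡; suc-injective; m+n∸n≡m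
        ; m≤n⇒m⊓n≡m; m≤n⇒m⊔n≡n; m≥n⇒m⊓n≡n; m≥n⇒m⊔n≡m; _≤?_ )
open import Data.Bool using (Bool; true; false)
import Data.Bool.Properties as Bool
open import Data.Fin using (Fin; toℕ; fromℕ<; inject₁; opposite) renaming (zero to 0F; suc to sucF)
open import Data.Fin.Properties
  using (toℕ-injective; toℕ≤pred[n]; toℕ-fromℕ; toℕ-fromℕ<; toℕ-inject₁; opposite-prop; opposite-suc; opposite-involutive; all?)
open import Data.Fin.Permutation
  using (Permutation; Permutation′; _⟨$⟩ʳ_; _⟨$⟩ˡ_; inverseˡ; inverseʳ; _∘ₚ_; flip; id; remove; lift₀-remove)
open import Data.Empty using (⊥; ⊥-elim)
open import Data.Product using (_,_; ∃-syntax)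
open import Data.Sum using (_⊎_; inj₁; inj₂)
import Data.Sum as Sum
open import Function using (_∘_)
open import Relation.Binary.PropositionalEquality
open import Relation.Nullary using (¬_; Dec; yes; no)
open import Relation.Nullary.Decidable using (_⊎-dec_)

module PathRigidity (N : ℕ) (g : ℕ → ℕ)
  (unitStep  : ∀ k → suc k ≤ N → suc (g k) ≡ g (suc k) ⊎ suc (g (suc k)) ≡ g k)
  (injective : ∀ i j → i ≤ N → j ≤ N → g i ≡ g j → i ≡ j)
  (bounded   : ∀ k → k ≤ N → g k ≤ N) where

  Ascending Descending : ℕ → Set
  Ascending  k = ∀ j → j ≤ k → g j ≡ g 0 + j
  Descending k = ∀ j → j ≤ k → g j + j ≡ g 0

  extendAscending : ∀ k → Ascending k → g (suc k) ≡ suc (g k) → Ascending (suc k)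
  extendAscending k asc up j j≤ with m≤n⇒m<n∨m≡n j≤
  ... | inj₁ j< = asc j (≤-pred j<)
  ... | inj₂ refl = trans up (trans (cong suc (asc k ≤-refl)) (sym (+-suc (g 0) k)))

  extendDescending : ∀ k → Descending k → suc (g (suc k)) ≡ g k → Descending (suc k)
  extendDescending k desc down j j≤ with m≤n⇒m<n∨m≡n j≤
  ... | inj₁ j< = desc j (≤-pred j<)
  ... | inj₂ refl = trans (+-suc (g (suc k)) k) (trans (cong (_+ k) down) (desc k ≤-refl))

  ascending₀ : Ascending 0
  ascending₀ zero _ = sym (+-identityʳ (g 0))

  descending₀ : Descending 0
  descending₀ zero _ = +-identityʳ (g 0)

  noReturn : ∀ k → suc (suc k) ≤ N → g (suc (suc k)) ≢ g k
  noReturn k le e with injective (suc (suc k)) k le (≤-trans (≤-trans (n≤1+n k) (n≤1+n (suc k))) le) e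
  ... | ()

  -- Hence the direction of the first step is kept all the way.
  monotone : ∀ k → k ≤ N → Ascending k ⊎ Descending k
  monotone zero _ = inj₁ ascending₀
  monotone (suc zero) le with unitStep 0 le
  ... | inj₁ up   = inj₁ (extendAscending 0 ascending₀ (sym up))
  ... | inj₂ down = inj₂ (extendDescending 0 descending₀ down)
  monotone (suc (suc k)) le with monotone (suc k) (≤-trans (n≤1+n (suc k)) le) | unitStep (suc k) le
  ... | inj₁ asc  | inj₁ up   = inj₁ (extendAscending (suc k) asc (sym up))
  ... | inj₂ desc | inj₂ down = inj₂ (extendDescending (suc k) desc down)
  ... | inj₁ asc  | inj₂ down = ⊥-elim (noReturn k le (suc-injective (begin
        suc (g (suc (suc k)))  ≡⟨ down ⟩
        g (suc k)              ≡⟨ asc (suc k) ≤-refl ⟩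
        g 0 + suc k            ≡⟨ +-suc (g 0) k ⟩
        suc (g 0 + k)          ≡⟨ cong suc (asc k (n≤1+n k)) ⟨
        suc (g k)              ∎)))
    where open ≡-Reasoning
  ... | inj₂ desc | inj₁ up   = ⊥-elim (noReturn k le (+-cancelʳ-≡ k _ _ (begin
        g (suc (suc k)) + k    ≡⟨ cong (_+ k) up ⟨
        suc (g (suc k)) + k    ≡⟨ +-suc (g (suc k)) k ⟨
        g (suc k) + suc k      ≡⟨ desc (suc k) ≤-refl ⟩
        g 0                    ≡⟨ desc k (n≤1+n k) ⟨
        g k + k                ∎)))
    where open ≡-Reasoning

  -- Boundedness pins the start: g 0 = 0 when ascending, g 0 = N when descending.
  rigid : (∀ k → k ≤ N → g k ≡ k) ⊎ (∀ k → k ≤ N → g k ≡ N ∸ k)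
  rigid with monotone N ≤-refl
  ... | inj₁ asc = inj₁ λ k k≤ → trans (asc k k≤) (cong (_+ k) start)
    where
    start : g 0 ≡ 0
    start = +-cancelʳ-≡ N (g 0) 0
      (≤-antisym (subst (_≤ N) (asc N ≤-refl) (bounded N ≤-refl)) (m≤n+m N (g 0)))
  ... | inj₂ desc = inj₂ λ k k≤ → trans (sym (m+n∸n≡m (g k) k)) (cong (_∸ k) (trans (desc k k≤) start))
    where
    start : g 0 ≡ N
    start = ≤-antisym (bounded 0 z≤n) (subst (N ≤_) (desc N ≤-refl) (m≤n+m N (g N)))

⟨$⟩ʳ-injective : ∀ {a b} (σ : Permutation a b) {x y : Fin a} → σ ⟨$⟩ʳ x ≡ σ ⟨$⟩ʳ y → x ≡ y
⟨$⟩ʳ-injective σ e = trans (sym (inverseˡ σ)) (trans (cong (σ ⟨$⟩ˡ_) e) (inverseˡ σ))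

Consecutive : ∀ {n} → Fin n → Fin n → Set
Consecutive x y = suc (toℕ x) ≡ toℕ y ⊎ suc (toℕ y) ≡ toℕ x

consecutive? : ∀ {n} (x y : Fin n) → Dec (Consecutive x y)
consecutive? x y = (suc (toℕ x) ≟ toℕ y) ⊎-dec (suc (toℕ y) ≟ toℕ x)

-- The vertex of Fin (suc N) with index k (defaulting to 0 out of range),
-- used to view maps on Fin (suc N) as maps on ℕ.
vertex : ∀ {N} → ℕ → Fin (suc N)
vertex {N} k with k <? suc N
... | yes k< = fromℕ< k<
... | no _   = 0F

toℕ-vertex : ∀ {N k} → k ≤ N → toℕ (vertex {N} k) ≡ k
toℕ-vertex {N} {k} k≤ with k <? suc N
... | yes k< = toℕ-fromℕ< k<
... | no k≮ = ⊥-elim (k≮ (s≤s k≤))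

vertex-toℕ : ∀ {N} (x : Fin (suc N)) → vertex (toℕ x) ≡ x
vertex-toℕ x = toℕ-injective (toℕ-vertex (toℕ≤pred[n] x))

pathSymmetry : ∀ {N} (σ : Permutation′ (suc N)) →
               (∀ x y → Consecutive x y → Consecutive (σ ⟨$⟩ʳ x) (σ ⟨$⟩ʳ y)) →
               (∀ x → σ ⟨$⟩ʳ x ≡ x) ⊎ (∀ x → σ ⟨$⟩ʳ x ≡ opposite x)
pathSymmetry {N} σ preserves =
  Sum.map fromIdentity fromReversal (PathRigidity.rigid N g unitStep injective bounded)
  where
  g : ℕ → ℕ
  g k = toℕ (σ ⟨$⟩ʳ vertex k)

  unitStep : ∀ k → suc k ≤ N → suc (g k) ≡ g (suc k) ⊎ suc (g (suc k)) ≡ g k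
  unitStep k k<N = preserves (vertex k) (vertex (suc k))
    (inj₁ (trans (cong suc (toℕ-vertex (≤-trans (n≤1+n k) k<N))) (sym (toℕ-vertex k<N))))

  injective : ∀ i j → i ≤ N → j ≤ N → g i ≡ g j → i ≡ j
  injective i j i≤ j≤ e = trans (sym (toℕ-vertex i≤))
    (trans (cong toℕ (⟨$⟩ʳ-injective σ (toℕ-injective e))) (toℕ-vertex j≤))

  bounded : ∀ k → k ≤ N → g k ≤ N
  bounded k _ = toℕ≤pred[n] (σ ⟨$⟩ʳ vertex k)

  atVertex : ∀ x → g (toℕ x) ≡ toℕ (σ ⟨$⟩ʳ x)
  atVertex x = cong (λ z → toℕ (σ ⟨$⟩ʳ z)) (vertex-toℕ x)

  fromIdentity : (∀ k → k ≤ N → g k ≡ k) → ∀ x → σ ⟨$⟩ʳ x ≡ x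
  fromIdentity h x = toℕ-injective (trans (sym (atVertex x)) (h (toℕ x) (toℕ≤pred[n] x)))

  fromReversal : (∀ k → k ≤ N → g k ≡ N ∸ k) → ∀ x → σ ⟨$⟩ʳ x ≡ opposite x
  fromReversal h x = toℕ-injective
    (trans (sym (atVertex x)) (trans (h (toℕ x) (toℕ≤pred[n] x)) (sym (opposite-prop x))))

neighbour : ∀ {n} (i : Fin (suc (suc n))) → ∃[ j ] Consecutive i j
neighbour 0F       = sucF 0F , inj₁ refl
neighbour (sucF i) = inject₁ i , inj₂ (cong suc (toℕ-inject₁ i))

InnerConsecutive : ∀ {n} → Fin (suc n) → Fin (suc n) → Set
InnerConsecutive 0F       _        = ⊥
InnerConsecutive (sucF i) 0F       = ⊥
InnerConsecutive (sucF i) (sucF j) = Consecutive i j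

innerConsecutive? : ∀ {n} (x y : Fin (suc n)) → Dec (InnerConsecutive x y)
innerConsecutive? 0F       _        = no λ ()
innerConsecutive? (sucF i) 0F       = no λ ()
innerConsecutive? (sucF i) (sucF j) = consecutive? i j

innerConsecutive-sym : ∀ {n} (x y : Fin (suc n)) → InnerConsecutive x y → InnerConsecutive y x
innerConsecutive-sym (sucF i) (sucF j) = Sum.swap

reflect₀ : ∀ {n} → Fin (suc n) → Fin (suc n)
reflect₀ 0F       = 0F
reflect₀ (sucF i) = sucF (opposite i)

-- Rigidity of the path 1 — ⋯ — n: a permutation preserving it fixes the
-- isolated vertex 0, so it restricts to a symmetry of the path on the
-- remaining vertices and is the identity or reflect₀.
pointedPathSymmetry : ∀ {n} (σ : Permutation′ (suc (suc (suc n)))) →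
  (∀ x y → InnerConsecutive x y → InnerConsecutive (σ ⟨$⟩ʳ x) (σ ⟨$⟩ʳ y)) →
  (∀ x → σ ⟨$⟩ʳ x ≡ x) ⊎ (∀ x → σ ⟨$⟩ʳ x ≡ reflect₀ x)
pointedPathSymmetry {n} σ preserves = Sum.map fromIdentity fromReversal (pathSymmetry ρ ρ-preserves)
  where
  hitsZero : ∀ {x} → σ ⟨$⟩ˡ 0F ≡ x → σ ⟨$⟩ʳ x ≡ 0F
  hitsZero e = trans (cong (σ ⟨$⟩ʳ_) (sym e)) (inverseʳ σ)

  -- A vertex with a red neighbour cannot be sent to the isolated vertex 0.
  fixesZero : σ ⟨$⟩ʳ 0F ≡ 0F
  fixesZero with σ ⟨$⟩ˡ 0F in e
  ... | 0F = hitsZero e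
  ... | sucF i with neighbour i
  ...   | j , i~j = ⊥-elim (subst (λ z → InnerConsecutive z (σ ⟨$⟩ʳ sucF j)) (hitsZero e)
                              (preserves (sucF i) (sucF j) i~j))

  ρ : Permutation′ (suc (suc n))
  ρ = remove 0F σ

  onSuc : ∀ i → σ ⟨$⟩ʳ sucF i ≡ sucF (ρ ⟨$⟩ʳ i)
  onSuc i = sym (lift₀-remove σ fixesZero (sucF i))

  ρ-preserves : ∀ x y → Consecutive x y → Consecutive (ρ ⟨$⟩ʳ x) (ρ ⟨$⟩ʳ y)
  ρ-preserves x y x~y = subst₂ InnerConsecutive (onSuc x) (onSuc y) (preserves (sucF x) (sucF y) x~y)

  fromIdentity : (∀ x → ρ ⟨$⟩ʳ x ≡ x) → ∀ x → σ ⟨$⟩ʳ x ≡ x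
  fromIdentity h 0F       = fixesZero
  fromIdentity h (sucF i) = trans (onSuc i) (cong sucF (h i))

  fromReversal : (∀ x → ρ ⟨$⟩ʳ x ≡ opposite x) → ∀ x → σ ⟨$⟩ʳ x ≡ reflect₀ x
  fromReversal h 0F       = fixesZero
  fromReversal h (sucF i) = trans (onSuc i) (cong sucF (h i))

-- Composing the two reflections gives the rotation x ↦ x − 1 (mod n + 1).
rotation : ∀ {n} → Fin (suc n) → Fin (suc n)
rotation x = opposite (reflect₀ x)

toℕ-rotation-zero : ∀ {n} → toℕ (rotation {n} 0F) ≡ n
toℕ-rotation-zero {n} = toℕ-fromℕ n

toℕ-rotation-suc : ∀ {n} (i : Fin n) → toℕ (rotation (sucF i)) ≡ toℕ i
toℕ-rotation-suc i = trans (opposite-suc (opposite i)) (cong toℕ (opposite-involutive i))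

IsSymmetry : (H : Graph) → (Fin (n H) → Fin (n H)) → Set
IsSymmetry H ρ = ∀ x y → Adj H (ρ x) (ρ y) ≡ Adj H x y

symmetry? : (H : Graph) (ρ : Fin (n H) → Fin (n H)) → Dec (IsSymmetry H ρ)
symmetry? H ρ = all? λ x → all? λ y → Adj H (ρ x) (ρ y) Bool.≟ Adj H x y

symmetry-∘ : ∀ (H : Graph) {ρ₁ ρ₂} → IsSymmetry H ρ₁ → IsSymmetry H ρ₂ → IsSymmetry H (ρ₁ ∘ ρ₂)
symmetry-∘ H {ρ₁} {ρ₂} s₁ s₂ x y = trans (s₁ (ρ₂ x) (ρ₂ y)) (s₂ x y)

colour : ∀ {P : Set} → Dec P → Fin 2
colour (yes _) = 0F
colour (no _)  = sucF 0F

colour-cong : ∀ {P Q : Set} → (P → Q) → (Q → P) → (p : Dec P) (q : Dec Q) → colour p ≡ colour q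
colour-cong to from (yes _) (yes _) = refl
colour-cong to from (yes p) (no ¬q) = ⊥-elim (¬q (to p))
colour-cong to from (no ¬p) (yes q) = ⊥-elim (¬p (from q))
colour-cong to from (no _)  (no _)  = refl

red : ∀ {P : Set} (p : Dec P) → colour p ≡ 0F → P
red (yes p) _ = p

-- Label-preserving automorphisms preserve R,
-- so if R is rigid enough that only the identity and one non-symmetry ρ
-- preserve it, the labeling is distinguishing.
module RedBlue (H : Graph) (R : Fin (n H) → Fin (n H) → Set)
  (R? : ∀ x y → Dec (R x y)) (R-sym : ∀ x y → R x y → R y x)
  (R⊆E : ∀ x y → R x y → Adj H x y ≡ true) where

  labeling : EdgeLabeling H 2
  labeling = record
    { ψ    = λ x y → colour (R? x y)
    ; ψsym = λ x y _ → colour-cong (R-sym x y) (R-sym y x) (R? x y) (R? y x) }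

  preservesRed : ∀ σ → PreservesLabels H labeling σ → ∀ x y → R x y → R (σ ⟨$⟩ʳ x) (σ ⟨$⟩ʳ y)
  preservesRed σ pres x y r = red (R? _ _) (trans (pres x y (R⊆E x y r)) (redColour (R? x y)))
    where
    redColour : (d : Dec (R x y)) → colour d ≡ 0F
    redColour (yes _) = refl
    redColour (no ¬r) = ⊥-elim (¬r r)

  distinguishing : (ρ : Fin (n H) → Fin (n H)) → ¬ IsSymmetry H ρ →
    (∀ σ → (∀ x y → R x y → R (σ ⟨$⟩ʳ x) (σ ⟨$⟩ʳ y)) → (∀ x → σ ⟨$⟩ʳ x ≡ x) ⊎ (∀ x → σ ⟨$⟩ʳ x ≡ ρ x)) →
    DistIndex≤ H 2
  distinguishing ρ asymmetric rigid = labeling , isDistinguishing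
    where
    isDistinguishing : IsDistinguishing H labeling
    isDistinguishing σ aut pres with rigid σ (preservesRed σ pres)
    ... | inj₁ identity = identity
    ... | inj₂ isρ = ⊥-elim (asymmetric λ x y → trans (cong₂ (Adj H) (sym (isρ x)) (sym (isρ y))) (aut x y))

pullback : ∀ {a b} (π : Permutation a b) (A : Fin a → Fin a → Bool) (B : Fin b → Fin b → Bool) →
           (∀ u v → B (π ⟨$⟩ʳ u) (π ⟨$⟩ʳ v) ≡ A u v) → ∀ x y → B x y ≡ A (π ⟨$⟩ˡ x) (π ⟨$⟩ˡ y)
pullback π A B carries x y = trans (sym (cong₂ B (inverseʳ π) (inverseʳ π))) (carries _ _)

≅-trans : ∀ {F G H} → F ≅ G → G ≅ H → F ≅ H
≅-trans (π₁ , e₁) (π₂ , e₂) = π₁ ∘ₚ π₂ , λ u v → trans (e₂ _ _) (e₁ u v)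

-- The distinguishing index is an isomorphism invariant: a distinguishing
-- labeling of H pulls back along G ≅ H, since conjugating an automorphism
-- of G by the isomorphism gives one of H.
≅-distIndex : ∀ {G H d} → G ≅ H → DistIndex≤ H d → DistIndex≤ G d
≅-distIndex {G} {H} {d} (π , iso) (L , distinguishingL) = L′ , distinguishingL′
  where
  L′ : EdgeLabeling G d
  L′ = record
    { ψ    = λ u v → ψ L (π ⟨$⟩ʳ u) (π ⟨$⟩ʳ v)
    ; ψsym = λ u v e → ψsym L _ _ (trans (iso u v) e) }

  back : ∀ x y → Adj H x y ≡ Adj G (π ⟨$⟩ˡ x) (π ⟨$⟩ˡ y)
  back = pullback π (Adj G) (Adj H) iso

  distinguishingL′ : IsDistinguishing G L′
  distinguishingL′ σ aut pres v = ⟨$⟩ʳ-injective π (begin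
      π ⟨$⟩ʳ (σ ⟨$⟩ʳ v)                    ≡⟨ cong (λ z → π ⟨$⟩ʳ (σ ⟨$⟩ʳ z)) (inverseˡ π) ⟨
      τ ⟨$⟩ʳ (π ⟨$⟩ʳ v)                    ≡⟨ distinguishingL τ τ-aut τ-pres (π ⟨$⟩ʳ v) ⟩
      π ⟨$⟩ʳ v                              ∎)
    where
    open ≡-Reasoning
    τ : Permutation′ (n H)
    τ = flip π ∘ₚ (σ ∘ₚ π)

    τ-aut : IsAutomorphism H τ
    τ-aut x y = trans (iso _ _) (trans (aut _ _) (sym (back x y)))

    τ-pres : PreservesLabels H L τ
    τ-pres x y e = trans (pres _ _ (trans (sym (back x y)) e))
                         (cong₂ (ψ L) (inverseʳ π) (inverseʳ π))

crossing : ∀ {m} {a b c d : Fin m} → toℕ a < toℕ b → toℕ c < toℕ d →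
           toℕ a < toℕ c → toℕ c < toℕ b → toℕ b < toℕ d → Crossing a b c d
crossing ab cd a<c c<b b<d
  rewrite m≤n⇒m⊓n≡m (<⇒≤ ab) | m≤n⇒m⊔n≡n (<⇒≤ ab) | m≤n⇒m⊓n≡m (<⇒≤ cd) | m≤n⇒m⊔n≡n (<⇒≤ cd)
  = inj₁ (a<c , c<b , b<d)

module Polygon (k : ℕ) (T : Fin (suc (suc (suc (suc k)))) → Fin (suc (suc (suc (suc k)))) → Bool)
  (T-sym : ∀ x y → T x y ≡ T y x) (T-irr : ∀ x → T x x ≡ false)
  (tri : IsPolygonTriangulation (suc (suc (suc (suc k)))) T) where
  open IsPolygonTriangulation tri

  M : ℕ
  M = suc (suc (suc k))

  P : Graph
  P = record { n = suc M ; Adj = T ; sym = T-sym ; irr = T-irr }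

  side : ∀ x y → Consecutive x y → T x y ≡ true
  side x y (inj₁ e) = sides x y e
  side x y (inj₂ e) = trans (T-sym x y) (sides y x e)

  innerSide : ∀ x y → InnerConsecutive x y → T x y ≡ true
  innerSide (sucF i) (sucF j) i~j = side (sucF i) (sucF j) (Sum.map (cong suc) (cong suc) i~j)

  record Diagonal : Set where
    field
      a b        : Fin (suc M)
      edge       : T a b ≡ true
      gap        : suc (suc (toℕ a)) ≤ toℕ b
      notClosing : toℕ a ≡ 0 → toℕ b < M

  two : Fin (suc M)
  two = sucF (sucF 0F)

  diagonalAt1 : ∀ x y → T x y ≡ true → 0 < toℕ x → toℕ x < 2 → 2 < toℕ y → Diagonal
  diagonalAt1 x y t 0<x x<2 2<y = record
    { a = x ; b = y ; edge = t ; gap = ≤-trans (s≤s (s≤s (≤-pred x<2))) 2<y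
    ; notClosing = λ x≡0 → ⊥-elim (<-irrefl (sym x≡0) 0<x) }

  crossing02 : ∀ c d → T c d ≡ true → CrossOrd 0 2 (toℕ c ⊓ toℕ d) (toℕ c ⊔ toℕ d) → Diagonal
  crossing02 c d t (0<c⊓d , c⊓d<2 , 2<c⊔d) with toℕ c ≤? toℕ d
  ... | yes c≤d = diagonalAt1 c d t
        (subst (0 <_) (m≤n⇒m⊓n≡m c≤d) 0<c⊓d) (subst (_< 2) (m≤n⇒m⊓n≡m c≤d) c⊓d<2)
        (subst (2 <_) (m≤n⇒m⊔n≡n c≤d) 2<c⊔d)
  ... | no c≰d = diagonalAt1 d c (trans (T-sym d c) t)
        (subst (0 <_) (m≥n⇒m⊓n≡n d≤c) 0<c⊓d) (subst (_< 2) (m≥n⇒m⊓n≡n d≤c) c⊓d<2)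
        (subst (2 <_) (m≥n⇒m⊔n≡m d≤c) 2<c⊔d)
    where
    d≤c : toℕ d ≤ toℕ c
    d≤c = <⇒≤ (≰⇒> c≰d)

  -- Either 02 is itself a diagonal (M ≥ 3), or by maximality an edge crosses it.
  diagonal : Diagonal
  diagonal with T 0F two in e
  ... | true  = record { a = 0F ; b = two ; edge = e ; gap = ≤-refl ; notClosing = λ _ → s≤s (s≤s (s≤s z≤n)) }
  ... | false with maximal 0F two (λ ()) e
  ...   | c , d , t , inj₁ crosses02 = crossing02 c d t crosses02
  ...   | _ , _ , _ , inj₂ (() , _)

  -- Rotating a diagonal ab by one step gives a chord crossing it, so the
  -- rotation cannot be a symmetry of the triangulation.
  rotationNotSymmetry : ¬ IsSymmetry P rotation
  rotationNotSymmetry rot = rotatedCrosses a b edge gap notClosing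
    where
    open Diagonal diagonal
    -- For x ≥ 1 the rotated chord is (x−1)(y−1), for x = 0 it is (y−1)M;
    -- either way its endpoints interleave with those of xy.
    rotatedCrosses : ∀ x y → T x y ≡ true → suc (suc (toℕ x)) ≤ toℕ y → (toℕ x ≡ 0 → toℕ y < M) → ⊥
    rotatedCrosses x 0F _ () _
    rotatedCrosses (sucF x′) (sucF y′) t (s≤s gap′) _ =
      nonCross (rotation (sucF x′)) (rotation (sucF y′)) (sucF x′) (sucF y′) (trans (rot _ _) t) t
        (crossing (subst₂ _<_ (sym rx) (sym ry) (≤-trans (n≤1+n _) gap′))
                  (s≤s (≤-trans (n≤1+n _) gap′))
                  (subst (_< suc (toℕ x′)) (sym rx) ≤-refl)
                  (subst (suc (toℕ x′) <_) (sym ry) gap′)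
                  (subst (_< suc (toℕ y′)) (sym ry) ≤-refl))
      where
      rx : toℕ (rotation (sucF x′)) ≡ toℕ x′
      rx = toℕ-rotation-suc x′
      ry : toℕ (rotation (sucF y′)) ≡ toℕ y′
      ry = toℕ-rotation-suc y′
    rotatedCrosses 0F (sucF y′) t (s≤s gap′) inner =
      nonCross 0F (sucF y′) (rotation (sucF y′)) (rotation 0F) t
        (trans (T-sym _ _) (trans (rot 0F (sucF y′)) t))
        (crossing (s≤s z≤n) (subst₂ _<_ (sym ry) (sym toℕ-rotation-zero) (≤-trans (n≤1+n _) y<M))
                  (subst (0 <_) (sym ry) gap′)
                  (subst (_< suc (toℕ y′)) (sym ry) ≤-refl)
                  (subst (suc (toℕ y′) <_) (sym toℕ-rotation-zero) y<M))
      where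
      ry : toℕ (rotation (sucF y′)) ≡ toℕ y′
      ry = toℕ-rotation-suc y′
      y<M : suc (toℕ y′) < M
      y<M = inner refl

  -- Labeling (A) works unless the reversal x ↦ M − x is a symmetry,
  -- labeling (B) unless reflect₀ is; both at once would make the rotation one.
  distIndex≤2 : DistIndex≤ P 2
  distIndex≤2 with symmetry? P opposite | symmetry? P reflect₀
  ... | no ¬opposite | _ =
    RedBlue.distinguishing P Consecutive consecutive? (λ _ _ → Sum.swap) side opposite ¬opposite pathSymmetry
  ... | yes _ | no ¬reflect₀ =
    RedBlue.distinguishing P InnerConsecutive innerConsecutive? innerConsecutive-sym innerSide
      reflect₀ ¬reflect₀ pointedPathSymmetry
  ... | yes opp | yes refl₀ = ⊥-elim (rotationNotSymmetry (symmetry-∘ P opp refl₀))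

polygonDistIndex : (P : Graph) → IsPolygonTriangulation (n P) (Adj P) → 4 ≤ n P → DistIndex≤ P 2
polygonDistIndex record { n = _ ; Adj = T ; sym = T-sym ; irr = T-irr } tri (s≤s (s≤s (s≤s (s≤s {n = k} _)))) =
  Polygon.distIndex≤2 k T T-sym T-irr tri

triangleIsK3 : (P : Graph) → IsPolygonTriangulation (n P) (Adj P) → n P ≡ 3 → P ≅ K3
triangleIsK3 record { n = _ ; Adj = T ; sym = T-sym ; irr = T-irr } tri refl = id , K3adj≡T
  where
  open IsPolygonTriangulation tri
  K3adj≡T : ∀ x y → K3adj x y ≡ T x y
  K3adj≡T 0F 0F = sym (T-irr 0F)
  K3adj≡T (sucF 0F) (sucF 0F) = sym (T-irr (sucF 0F))
  K3adj≡T (sucF (sucF 0F)) (sucF (sucF 0F)) = sym (T-irr (sucF (sucF 0F)))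
  K3adj≡T 0F (sucF 0F) = sym (sides 0F (sucF 0F) refl)
  K3adj≡T (sucF 0F) (sucF (sucF 0F)) = sym (sides (sucF 0F) (sucF (sucF 0F)) refl)
  K3adj≡T 0F (sucF (sucF 0F)) = sym (closing 0F (sucF (sucF 0F)) refl refl)
  K3adj≡T (sucF 0F) 0F = trans (K3adj≡T 0F (sucF 0F)) (T-sym 0F (sucF 0F))
  K3adj≡T (sucF (sucF 0F)) (sucF 0F) = trans (K3adj≡T (sucF 0F) (sucF (sucF 0F))) (T-sym (sucF 0F) (sucF (sucF 0F)))
  K3adj≡T (sucF (sucF 0F)) 0F = trans (K3adj≡T 0F (sucF (sucF 0F))) (T-sym 0F (sucF (sucF 0F)))

polygonGraph : (G : Graph) → MaximalOuterplanar G → Graph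
polygonGraph G (T , _ , π , carries) = record
  { n = n G ; Adj = T
  ; sym = λ x y → trans (back x y) (trans (Graph.sym G _ _) (sym (back y x)))
  ; irr = λ x → trans (back x x) (irr G _) }
  where
  back : ∀ x y → T x y ≡ Adj G (π ⟨$⟩ˡ x) (π ⟨$⟩ˡ y)
  back = pullback π (Adj G) T carries

mainTheorem5 : (G : Graph) → MaximalOuterplanar G → ¬ (G ≅ K3) → DistIndex≤ G 2
mainTheorem5 G outerplanar@(T , tri , π , carries) G≇K3 =
  Sum.[ (λ 3<n → ≅-distIndex G≅P (polygonDistIndex P tri 3<n))
      , (λ 3≡n → ⊥-elim (G≇K3 (≅-trans {G} {P} {K3} G≅P (triangleIsK3 P tri (sym 3≡n)))))
      ]′ (m≤n⇒m<n∨m≡n (IsPolygonTriangulation.three≤m tri))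
  where
  P : Graph
  P = polygonGraph G outerplanar
  G≅P : G ≅ P
  G≅P = π , carries
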